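{- Let $\tau_2=\underline{1}32$. For $n\ge1$ and any integer $k$, let $P_{n,\tau_2,k}(x)=\sum x^{pmp_{\tau_2}(\sigma)}$, the sum over all $\sigma\in S_n$ whose last descent is at position $k$ (so $P_{n,\tau_2,k}(x)=0$ unless $1\le k\le n-1$; in particular $P_{n,\tau_2,0}=P_{n,\tau_2,n}=0$). Then for all $n\ge2$ and $1\le k\le n-1$, $$P_{n,\tau_2,k}(x)=(k-1)x\,P_{n-1,\tau_2,k-1}(x)+1+\sum_{\ell=1}^{k}P_{n-1,\tau_2,\ell}(x).$$
   Context: A permutation $\sigma\in S_n$ has its last descent at position $k$ if $\sigma_k>\sigma_{k+1}<\sigma_{k+2}<\cdots<\sigma_n$. For $\sigma\in S_n$, $\sigma$ has a $\underline{1}32$-match at position $\ell$ if there exist $j,m$ with $\ell<j<m$ and $\sigma_\ell<\sigma_m<\sigma_j$; $pmp_{\underline{1}32}(\sigma)$ is the number of such positions $\ell$. -}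

module Defs where

open import Data.Nat using (ℕ; zero; suc; _+_; _*_; _∸_; _<ᵇ_; _≡ᵇ_)
open import Data.Bool using (Bool; true; false; _∧_; if_then_else_)
open import Data.List using (List; []; _∷_; map; concatMap; filter; filterᵇ; length; foldr)
open import Data.Bool.ListAction using (any; all)
open import Data.List.Relation.Unary.Unique.DecPropositional using (unique?)
open import Data.Nat.Properties using (_≟_)
open import Relation.Nullary.Decidable using (does)

range : ℕ → ℕ → List ℕ
range a zero = []
range a (suc len) = a ∷ range (suc a) len

_⋯_ : ℕ → ℕ → List ℕ
a ⋯ b = range a ((suc b) ∸ a)

words : ℕ → ℕ → List (List ℕ)
words n zero = [] ∷ []
words n (suc m) = concatMap (λ v → map (v ∷_) (words n m)) (1 ⋯ n)

-- S_n : permutations of {1,...,n} in one-line notation σ₁σ₂…σₙ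
-- (words of length n over {1..n} with pairwise distinct letters)
S : ℕ → List (List ℕ)
S n = filter (λ w → unique? _≟_ w) (words n n)

-- 1-indexed entry σ_i (default 0 outside range)
at : List ℕ → ℕ → ℕ
at [] i = 0
at (x ∷ σ) zero = 0
at (x ∷ σ) (suc zero) = x
at (x ∷ σ) (suc (suc i)) = at σ (suc i)

lastDescentAt : List ℕ → ℕ → Bool
lastDescentAt σ k =
  (0 <ᵇ k) ∧ (k <ᵇ length σ) ∧ (at σ (suc k) <ᵇ at σ k)
  ∧ all (λ i → at σ i <ᵇ at σ (suc i)) ((suc k) ⋯ (length σ ∸ 1))

match132At : List ℕ → ℕ → Bool
match132At σ ℓ =
  any (λ j → any (λ m → (at σ ℓ <ᵇ at σ m) ∧ (at σ m <ᵇ at σ j))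
                 ((suc j) ⋯ length σ))
      ((suc ℓ) ⋯ length σ)

pmp132 : List ℕ → ℕ
pmp132 σ = length (filterᵇ (λ ℓ → match132At σ ℓ) (1 ⋯ length σ))

-- polynomials with natural-number coefficients, as coefficient functions
Poly : Set
Poly = ℕ → ℕ

-- P_{n,τ₂,k}(x): coefficient of x^j is #{σ ∈ S_n : last descent at k, pmp(σ) = j}
P : ℕ → ℕ → Poly
P n k j = length (filterᵇ (λ σ → lastDescentAt σ k ∧ (pmp132 σ ≡ᵇ j)) (S n))

_⊕_ : Poly → Poly → Poly
(p ⊕ q) j = p j + q j
infixl 6 _⊕_

_⊙_ : ℕ → Poly → Poly
(c ⊙ p) j = c * p j
infixl 7 _⊙_

X* : Poly → Poly
X* p zero = 0
X* p (suc j) = p j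

one : Poly
one zero = 1
one (suc j) = 0

zeroP : Poly
zeroP j = 0

ΣP : ℕ → ℕ → (ℕ → Poly) → Poly
ΣP a b f = foldr (λ ℓ acc → f ℓ ⊕ acc) zeroP (a ⋯ b)

-- Every σ ∈ S n arises exactly once by inserting the letter 1, at one of n positions,
-- into the shifted word τ + 1 of some τ ∈ S (n - 1).  The new 1 starts a 1̲32-match iff
-- a descent follows it, and it creates or destroys no other match.  So σ has its last
-- descent at k iff either 1 is inserted at one of the positions 1, …, k - 1 and τ has
-- its last descent at k - 1, which adds one match (the term (k - 1) x P), or 1 is
-- inserted at position k + 1 and τ ascends from position k + 1 on.  Finally, τ ascends
-- from position k + 1 on iff τ is the identity (no match: the summand 1) or its last
-- descent is at some ℓ ≤ k.

module Submission where

open import Defs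
open import Data.Bool using (Bool; true; false; _∧_; _∨_; T)
open import Data.Bool.ListAction using (any; all; or; and)
open import Data.Bool.Properties using (∧-zeroʳ; T-∧; T-∨; T-≡)
open import Data.List
  using (List; []; _∷_; map; filterᵇ; length; foldr; drop; _++_; concatMap; cartesianProduct; cartesianProductWith)
open import Data.List.Properties
  using (map-∘; map-cong; map-++; drop-map; drop-drop; ∷-injective; ∷-injectiveʳ; map-injective;
         length-++; length-map; length-++-≤ˡ)
open import Data.List.Membership.Propositional using (_∈_)
open import Data.List.Membership.Propositional.Properties
  using (∈-map⁺; ∈-map⁻; ∈-filter⁺; ∈-filter⁻; ∈-∃++; ∈-++⁻; ∈-++⁺ˡ; ∈-++⁺ʳ; ∈-cartesianProduct⁺;
         ∈-cartesianProduct⁻; ∈-cartesianProductWith⁺; ∈-cartesianProductWith⁻)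
open import Data.List.Membership.Propositional.Properties.WithK using (unique∧set⇒bag)
open import Data.List.Relation.Binary.BagAndSetEquality using (∼bag⇒↭)
open import Data.List.Relation.Binary.Permutation.Propositional using (_↭_)
open import Data.List.Relation.Binary.Permutation.Propositional.Properties using (map⁺)
open import Data.List.Relation.Unary.All as All using (All; []; _∷_)
import Data.List.Relation.Unary.All.Properties as All
open import Data.List.Relation.Unary.AllPairs using ([]; _∷_)
open import Data.List.Relation.Unary.Any using (here; there)
open import Data.List.Relation.Unary.Unique.DecPropositional using (unique?)
open import Data.List.Relation.Unary.Unique.Propositional using (Unique)
import Data.List.Relation.Unary.Unique.Propositional.Properties as Unique
open import Data.Nat using (ℕ; zero; suc; _+_; _*_; _∸_; _≤_; _<_; z≤n; s≤s; z<s; _<ᵇ_; _≡ᵇ_)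
open import Data.Nat.ListAction using (sum)
open import Data.Nat.ListAction.Properties using (sum-++; sum-↭)
open import Data.Nat.Properties
open import Data.List.Membership.DecPropositional _≟_ using (_∈?_)
open import Data.Product using (_×_; _,_; proj₁; proj₂; ∃)
open import Data.Sum using (inj₁; inj₂)
open import Function using (_∘_)
open import Function.Bundles using (Equivalence; mk⇔)
open import Relation.Binary.PropositionalEquality
open import Relation.Nullary using (yes; no; contradiction)

open import Algebra.Properties.CommutativeSemigroup +-commutativeSemigroup using (interchange)

-- Sums over lists

private variable A B : Set

𝟙 : Bool → ℕ
𝟙 true = 1
𝟙 false = 0

𝟙-∧ : ∀ a b → 𝟙 (a ∧ b) ≡ 𝟙 a * 𝟙 b
𝟙-∧ true b = sym (+-identityʳ (𝟙 b))
𝟙-∧ false b = refl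

∧-congʳ-if : ∀ b (f : A → Bool) {c c′} → (T b → c ≡ c′) → b ∧ f c ≡ b ∧ f c′
∧-congʳ-if true f c≡c′ = cong f (c≡c′ _)
∧-congʳ-if false f c≡c′ = refl

∑ : List A → (A → ℕ) → ℕ
∑ xs f = sum (map f xs)

syntax ∑ xs (λ x → e) = ∑[ x ∈ xs ] e

length-filterᵇ : ∀ (p : A → Bool) xs → length (filterᵇ p xs) ≡ ∑[ x ∈ xs ] 𝟙 (p x)
length-filterᵇ p [] = refl
length-filterᵇ p (x ∷ xs) with p x
... | true = cong suc (length-filterᵇ p xs)
... | false = length-filterᵇ p xs

∑-cong : ∀ {f g : A → ℕ} → (∀ x → f x ≡ g x) → ∀ xs → ∑ xs f ≡ ∑ xs g
∑-cong f≗g xs = cong sum (map-cong f≗g xs)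

∑-cong-∈ : ∀ {f g : A → ℕ} xs → (∀ {x} → x ∈ xs → f x ≡ g x) → ∑ xs f ≡ ∑ xs g
∑-cong-∈ [] f≗g = refl
∑-cong-∈ (x ∷ xs) f≗g = cong₂ _+_ (f≗g (here refl)) (∑-cong-∈ xs (λ x∈ → f≗g (there x∈)))

∑-map : ∀ (f : B → ℕ) (g : A → B) xs → ∑ (map g xs) f ≡ ∑[ x ∈ xs ] f (g x)
∑-map f g xs = cong sum (sym (map-∘ xs))

∑-++ : ∀ xs ys (f : A → ℕ) → ∑ (xs ++ ys) f ≡ ∑ xs f + ∑ ys f
∑-++ xs ys f = trans (cong sum (map-++ f xs ys)) (sum-++ (map f xs) (map f ys))

∑-const : ∀ (xs : List A) c → ∑[ x ∈ xs ] c ≡ length xs * c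
∑-const [] c = refl
∑-const (x ∷ xs) c = cong (c +_) (∑-const xs c)

∑-const-∈ : ∀ {f : A → ℕ} xs c → (∀ {x} → x ∈ xs → f x ≡ c) → ∑ xs f ≡ length xs * c
∑-const-∈ xs c f≡c = trans (∑-cong-∈ xs f≡c) (∑-const xs c)

∑-+ : ∀ xs (f g : A → ℕ) → ∑[ x ∈ xs ] (f x + g x) ≡ ∑ xs f + ∑ xs g
∑-+ [] f g = refl
∑-+ (x ∷ xs) f g =
  trans (cong (f x + g x +_) (∑-+ xs f g)) (interchange (f x) (g x) (∑ xs f) (∑ xs g))

∑-*ˡ : ∀ xs c (f : A → ℕ) → ∑[ x ∈ xs ] (c * f x) ≡ c * ∑ xs f
∑-*ˡ [] c f = sym (*-zeroʳ c)
∑-*ˡ (x ∷ xs) c f = trans (cong (c * f x +_) (∑-*ˡ xs c f)) (sym (*-distribˡ-+ c (f x) (∑ xs f)))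

∑-*ʳ : ∀ xs c (f : A → ℕ) → ∑[ x ∈ xs ] (f x * c) ≡ ∑ xs f * c
∑-*ʳ xs c f = trans (∑-cong (λ x → *-comm (f x) c) xs) (trans (∑-*ˡ xs c f) (*-comm c (∑ xs f)))

∑-swap : ∀ xs (ys : List B) (f : A → B → ℕ) →
  ∑[ x ∈ xs ] ∑[ y ∈ ys ] f x y ≡ ∑[ y ∈ ys ] ∑[ x ∈ xs ] f x y
∑-swap [] ys f = sym (trans (∑-const ys 0) (*-zeroʳ (length ys)))
∑-swap (x ∷ xs) ys f =
  trans (cong (∑ ys (f x) +_) (∑-swap xs ys f)) (sym (∑-+ ys (f x) (λ y → ∑[ x ∈ xs ] f x y)))

∑-cartesianProduct : ∀ xs (ys : List B) (f : A × B → ℕ) →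
  ∑ (cartesianProduct xs ys) f ≡ ∑[ x ∈ xs ] ∑[ y ∈ ys ] f (x , y)
∑-cartesianProduct [] ys f = refl
∑-cartesianProduct (x ∷ xs) ys f =
  trans (∑-++ (map (x ,_) ys) (cartesianProduct xs ys) f)
        (cong₂ _+_ (∑-map f (x ,_) ys) (∑-cartesianProduct xs ys f))

∑-↭ : ∀ {xs ys} (f : A → ℕ) → xs ↭ ys → ∑ xs f ≡ ∑ ys f
∑-↭ f xs↭ys = sum-↭ (map⁺ f xs↭ys)


-- Ranges

range-suc : ∀ a L → range (suc a) L ≡ map suc (range a L)
range-suc a zero = refl
range-suc a (suc L) = cong (suc a ∷_) (range-suc (suc a) L)

map-range-suc : ∀ (g : ℕ → A) a L → map g (range (suc a) L) ≡ map (λ i → g (suc i)) (range a L)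
map-range-suc g a L = trans (cong (map g) (range-suc a L)) (sym (map-∘ (range a L)))

range-++ : ∀ a b c → range a (b + c) ≡ range a b ++ range (a + b) c
range-++ a zero c = cong (λ a′ → range a′ c) (sym (+-identityʳ a))
range-++ a (suc b) c =
  cong (a ∷_) (trans (range-++ (suc a) b c) (cong (λ a′ → range (suc a) b ++ range a′ c) (sym (+-suc a b))))

length-range : ∀ a L → length (range a L) ≡ L
length-range a zero = refl
length-range a (suc L) = cong suc (length-range (suc a) L)

∈-range⁻ : ∀ {x} a L → x ∈ range a L → a ≤ x × x < a + L
∈-range⁻ a (suc L) (here refl) = ≤-refl , m<m+n a z<s
∈-range⁻ {x} a (suc L) (there x∈) with ∈-range⁻ (suc a) L x∈
... | a<x , x<a+1+L = <⇒≤ a<x , subst (x <_) (sym (+-suc a L)) x<a+1+L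

∈-range⁺ : ∀ {x} a L → a ≤ x → x < a + L → x ∈ range a L
∈-range⁺ a zero a≤x x<a+0 = contradiction (subst (_ <_) (+-identityʳ a) x<a+0) (≤⇒≯ a≤x)
∈-range⁺ {x} a (suc L) a≤x x<a+1+L with m≤n⇒m<n∨m≡n a≤x
... | inj₂ refl = here refl
... | inj₁ a<x = there (∈-range⁺ (suc a) L a<x (subst (x <_) (+-suc a L) x<a+1+L))

range-unique : ∀ a L → Unique (range a L)
range-unique a zero = []
range-unique a (suc L) =
  All.tabulate (λ x∈ a≡x → <-irrefl a≡x (proj₁ (∈-range⁻ (suc a) L x∈))) ∷ range-unique (suc a) L

∑-range-suc : ∀ a L (f : ℕ → ℕ) → ∑ (range a (suc L)) f ≡ ∑ (range a L) f + f (a + L)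
∑-range-suc a L f = begin
  ∑ (range a (suc L)) f                 ≡⟨ cong (λ n → ∑ (range a n) f) (+-comm 1 L) ⟩
  ∑ (range a (L + 1)) f                 ≡⟨ cong (λ is → ∑ is f) (range-++ a L 1) ⟩
  ∑ (range a L ++ range (a + L) 1) f    ≡⟨ ∑-++ (range a L) (range (a + L) 1) f ⟩
  ∑ (range a L) f + (f (a + L) + 0)     ≡⟨ cong (∑ (range a L) f +_) (+-identityʳ (f (a + L))) ⟩
  ∑ (range a L) f + f (a + L)           ∎
  where open ≡-Reasoning


-- Structural form of the statistics

mapSuffixes : (ℕ → List ℕ → A) → List ℕ → List A
mapSuffixes F [] = []
mapSuffixes F (y ∷ ys) = F y ys ∷ mapSuffixes F ys

mapSuffixes≡map : ∀ (f : ℕ → A) ys → mapSuffixes (λ y _ → f y) ys ≡ map f ys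
mapSuffixes≡map f [] = refl
mapSuffixes≡map f (y ∷ ys) = cong (f y ∷_) (mapSuffixes≡map f ys)

map-positions : ∀ (F : ℕ → List ℕ → A) a σ →
  map (λ j → F (at σ j) (drop j σ)) (suc a ⋯ length σ) ≡ mapSuffixes F (drop a σ)
map-positions F a σ = trans (map-range-suc _ a (length σ ∸ a)) (from a σ)
  where
  from : ∀ a σ → map (λ j → F (at σ (suc j)) (drop (suc j) σ)) (range a (length σ ∸ a))
                 ≡ mapSuffixes F (drop a σ)
  from zero [] = refl
  from zero (x ∷ σ) = cong (F x σ ∷_) (trans (map-range-suc _ 0 (length σ)) (from zero σ))
  from (suc a) [] = refl
  from (suc a) (x ∷ σ) = trans (map-range-suc _ a (length σ ∸ a)) (from a σ)

ascending : List ℕ → Bool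
ascending (x ∷ y ∷ r) = (x <ᵇ y) ∧ ascending (y ∷ r)
ascending _ = true

lastDescentAtHead : List ℕ → Bool
lastDescentAtHead (x ∷ y ∷ r) = (y <ᵇ x) ∧ ascending (y ∷ r)
lastDescentAtHead _ = false

lastDescentAt′ : List ℕ → ℕ → Bool
lastDescentAt′ σ zero = false
lastDescentAt′ σ (suc k) = lastDescentAtHead (drop k σ)

-- starts132 x ys: the word x ∷ ys has a 1̲32-match at its first position.
starts132 : ℕ → List ℕ → Bool
starts132 x = or ∘ mapSuffixes (λ y zs → any (λ z → (x <ᵇ z) ∧ (z <ᵇ y)) zs)

pmp132′ : List ℕ → ℕ
pmp132′ = sum ∘ mapSuffixes (λ y ys → 𝟙 (starts132 y ys))

all-ascents : ∀ a σ →
  all (λ i → at σ i <ᵇ at σ (suc i)) (suc a ⋯ (length σ ∸ 1)) ≡ ascending (drop a σ)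
all-ascents a σ =
  trans (cong (λ L → all ascent (range (suc a) L)) (∸-+-assoc (length σ) 1 a))
        (trans (cong and (map-range-suc ascent a (length σ ∸ suc a))) (from a σ))
  where
  ascent : ℕ → Bool
  ascent i = at σ i <ᵇ at σ (suc i)
  from : ∀ a σ → all (λ i → at σ (suc i) <ᵇ at σ (suc (suc i))) (range a (length σ ∸ suc a))
                 ≡ ascending (drop a σ)
  from zero [] = refl
  from zero (x ∷ []) = refl
  from zero (x ∷ y ∷ r) =
    cong ((x <ᵇ y) ∧_) (trans (cong and (map-range-suc _ 0 (length r))) (from zero (y ∷ r)))
  from (suc a) [] = refl
  from (suc a) (x ∷ σ) = trans (cong and (map-range-suc _ a (length σ ∸ suc a))) (from a σ)

lastDescentAt≡lastDescentAt′ : ∀ σ k → lastDescentAt σ k ≡ lastDescentAt′ σ k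
lastDescentAt≡lastDescentAt′ σ zero = refl
lastDescentAt≡lastDescentAt′ σ (suc k) =
  trans (cong (λ b → (suc k <ᵇ length σ) ∧ (at σ (suc (suc k)) <ᵇ at σ (suc k)) ∧ b)
              (all-ascents (suc k) σ))
        (head k σ)
  where
  head : ∀ k σ → (suc k <ᵇ length σ) ∧ (at σ (suc (suc k)) <ᵇ at σ (suc k))
                   ∧ ascending (drop (suc k) σ)
                 ≡ lastDescentAtHead (drop k σ)
  head zero [] = refl
  head zero (x ∷ []) = refl
  head zero (x ∷ y ∷ r) = refl
  head (suc k) [] = refl
  head (suc k) (x ∷ σ) = head k σ

match132At≡starts132 : ∀ σ ℓ → match132At σ ℓ ≡ starts132 (at σ ℓ) (drop ℓ σ)
match132At≡starts132 σ ℓ =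
  cong or (trans (map-cong middle (suc ℓ ⋯ length σ)) (map-positions _ ℓ σ))
  where
  x : ℕ
  x = at σ ℓ
  middle : ∀ j → any (λ m → (x <ᵇ at σ m) ∧ (at σ m <ᵇ at σ j)) (suc j ⋯ length σ)
                 ≡ any (λ z → (x <ᵇ z) ∧ (z <ᵇ at σ j)) (drop j σ)
  middle j = cong or (trans (map-positions (λ z _ → (x <ᵇ z) ∧ (z <ᵇ at σ j)) j σ)
                            (mapSuffixes≡map _ (drop j σ)))

pmp132≡pmp132′ : ∀ σ → pmp132 σ ≡ pmp132′ σ
pmp132≡pmp132′ σ = begin
  pmp132 σ
    ≡⟨ length-filterᵇ (match132At σ) (1 ⋯ length σ) ⟩
  ∑[ ℓ ∈ 1 ⋯ length σ ] 𝟙 (match132At σ ℓ)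
    ≡⟨ ∑-cong (λ ℓ → cong 𝟙 (match132At≡starts132 σ ℓ)) (1 ⋯ length σ) ⟩
  ∑[ ℓ ∈ 1 ⋯ length σ ] 𝟙 (starts132 (at σ ℓ) (drop ℓ σ))
    ≡⟨ cong sum (map-positions _ 0 σ) ⟩
  pmp132′ σ ∎
  where open ≡-Reasoning

ΣP-∑ : ∀ a b (F : ℕ → Poly) j → ΣP a b F j ≡ ∑[ ℓ ∈ a ⋯ b ] F ℓ j
ΣP-∑ a b F j = go (a ⋯ b)
  where
  go : ∀ ℓs → foldr (λ ℓ acc → F ℓ ⊕ acc) zeroP ℓs j ≡ ∑[ ℓ ∈ ℓs ] F ℓ j
  go [] = refl
  go (ℓ ∷ ℓs) = cong (F ℓ j +_) (go ℓs)

P≡∑ : ∀ n k j → P n k j ≡ ∑[ σ ∈ S n ] 𝟙 (lastDescentAt′ σ k ∧ (pmp132′ σ ≡ᵇ j))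
P≡∑ n k j = trans (length-filterᵇ _ (S n))
  (∑-cong (λ σ → cong₂ (λ d p → 𝟙 (d ∧ (p ≡ᵇ j)))
                       (lastDescentAt≡lastDescentAt′ σ k) (pmp132≡pmp132′ σ)) (S n))


-- Inserting the new minimum

-- The index i is 0-based, unlike the positions in Defs; for i ≥ length xs, 1 is appended.
insertOne : ℕ → List ℕ → List ℕ
insertOne zero xs = 1 ∷ xs
insertOne (suc i) [] = 1 ∷ []
insertOne (suc i) (x ∷ xs) = x ∷ insertOne i xs

Positive : List ℕ → Set
Positive = All (0 <_)

ascending-map-suc : ∀ xs → ascending (map suc xs) ≡ ascending xs
ascending-map-suc [] = refl
ascending-map-suc (x ∷ []) = refl
ascending-map-suc (x ∷ y ∷ r) = cong ((x <ᵇ y) ∧_) (ascending-map-suc (y ∷ r))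

lastDescentAtHead-map-suc : ∀ xs → lastDescentAtHead (map suc xs) ≡ lastDescentAtHead xs
lastDescentAtHead-map-suc [] = refl
lastDescentAtHead-map-suc (x ∷ []) = refl
lastDescentAtHead-map-suc (x ∷ y ∷ r) = cong ((y <ᵇ x) ∧_) (ascending-map-suc (y ∷ r))

any-map : ∀ (f : B → Bool) (g : A → B) xs → any f (map g xs) ≡ any (f ∘ g) xs
any-map f g xs = cong or (sym (map-∘ xs))

starts132-map-suc : ∀ x ys → starts132 (suc x) (map suc ys) ≡ starts132 x ys
starts132-map-suc x [] = refl
starts132-map-suc x (y ∷ ys) =
  cong₂ _∨_ (any-map (λ z → (suc x <ᵇ z) ∧ (z <ᵇ suc y)) suc ys) (starts132-map-suc x ys)

pmp132′-map-suc : ∀ τ → pmp132′ (map suc τ) ≡ pmp132′ τ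
pmp132′-map-suc [] = refl
pmp132′-map-suc (x ∷ τ) = cong₂ (λ b p → 𝟙 b + p) (starts132-map-suc x τ) (pmp132′-map-suc τ)

any-insertOne : ∀ (f : ℕ → Bool) i ys → f 1 ≡ false → any f (insertOne i ys) ≡ any f ys
any-insertOne f zero ys f1 = cong (_∨ any f ys) f1
any-insertOne f (suc i) [] f1 = cong (_∨ false) f1
any-insertOne f (suc i) (y ∷ ys) f1 = cong (f y ∨_) (any-insertOne f i ys f1)

starts132-insertOne : ∀ x i ys → starts132 (suc x) (insertOne i ys) ≡ starts132 (suc x) ys
starts132-insertOne x zero ys = cong (_∨ starts132 (suc x) ys) (no-middle ys)
  where
  no-middle : ∀ zs → any (λ z → (suc x <ᵇ z) ∧ (z <ᵇ 1)) zs ≡ false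
  no-middle [] = refl
  no-middle (zero ∷ zs) = no-middle zs
  no-middle (suc z ∷ zs) = cong₂ _∨_ (∧-zeroʳ (x <ᵇ z)) (no-middle zs)
starts132-insertOne x (suc i) [] = refl
starts132-insertOne x (suc i) (y ∷ ys) =
  cong₂ _∨_ (any-insertOne (λ z → (suc x <ᵇ z) ∧ (z <ᵇ y)) i ys refl) (starts132-insertOne x i ys)

pmp132′-insertOne : ∀ i τ → pmp132′ (insertOne i (map suc τ)) ≡ pmp132′ τ + 𝟙 (starts132 0 (drop i τ))
pmp132′-insertOne zero τ =
  trans (cong₂ (λ b p → 𝟙 b + p) (starts132-map-suc 0 τ) (pmp132′-map-suc τ))
        (+-comm (𝟙 (starts132 0 τ)) (pmp132′ τ))
pmp132′-insertOne (suc i) [] = refl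
pmp132′-insertOne (suc i) (t ∷ τ) =
  trans (cong₂ (λ b p → 𝟙 b + p) (trans (starts132-insertOne t i (map suc τ)) (starts132-map-suc t τ))
                                 (pmp132′-insertOne i τ))
        (sym (+-assoc (𝟙 (starts132 t τ)) (pmp132′ τ) _))

<ᵇ-false : ∀ {m n} → n ≤ m → (m <ᵇ n) ≡ false
<ᵇ-false z≤n = refl
<ᵇ-false (s≤s n≤m) = <ᵇ-false n≤m

ascending-tail : ∀ y ys → T (ascending (y ∷ ys)) → T (ascending ys)
ascending-tail y [] _ = _
ascending-tail y (z ∷ zs) asc = proj₂ (Equivalence.to T-∧ asc)

ascending-head : ∀ y ys → T (ascending (y ∷ ys)) → All (y <_) ys
ascending-head y [] _ = []
ascending-head y (z ∷ zs) asc with Equivalence.to T-∧ asc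
... | y<ᵇz , asc′ = y<z ∷ All.map (<-trans y<z) (ascending-head z zs asc′)
  where
  y<z : y < z
  y<z = <ᵇ⇒< y z y<ᵇz

ascending⇒¬starts132 : ∀ x ys → T (ascending ys) → starts132 x ys ≡ false
ascending⇒¬starts132 x [] _ = refl
ascending⇒¬starts132 x (y ∷ ys) asc =
  cong₂ _∨_ (no-middle ys (ascending-head y ys asc)) (ascending⇒¬starts132 x ys (ascending-tail y ys asc))
  where
  no-middle : ∀ zs → All (y <_) zs → any (λ z → (x <ᵇ z) ∧ (z <ᵇ y)) zs ≡ false
  no-middle [] [] = refl
  no-middle (z ∷ zs) (y<z ∷ y<zs) =
    cong₂ _∨_ (trans (cong ((x <ᵇ z) ∧_) (<ᵇ-false (<⇒≤ y<z))) (∧-zeroʳ (x <ᵇ z)))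
              (no-middle zs y<zs)

lastDescentAtHead⇒starts132 : ∀ i d τ → Positive τ → i ≤ d →
  T (lastDescentAtHead (drop d τ)) → T (starts132 0 (drop i τ))
lastDescentAtHead⇒starts132 zero zero (a ∷ b ∷ r) (_ ∷ 0<b ∷ _) _ ld =
  Equivalence.from T-∨ (inj₁ (Equivalence.from T-∨ (inj₁
    (Equivalence.from T-∧ (<⇒<ᵇ 0<b , proj₁ (Equivalence.to T-∧ ld))))))
lastDescentAtHead⇒starts132 zero (suc d) (a ∷ τ) (_ ∷ pos) _ ld =
  Equivalence.from T-∨ (inj₂ (lastDescentAtHead⇒starts132 zero d τ pos z≤n ld))
lastDescentAtHead⇒starts132 (suc i) (suc d) (a ∷ τ) (_ ∷ pos) (s≤s i≤d) ld =
  lastDescentAtHead⇒starts132 i d τ pos i≤d ld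

drop-insertOne-before : ∀ i d xs → i ≤ d → drop (suc d) (insertOne i xs) ≡ drop d xs
drop-insertOne-before zero d xs _ = refl
drop-insertOne-before (suc i) (suc d) [] _ = refl
drop-insertOne-before (suc i) (suc d) (x ∷ xs) (s≤s i≤d) = drop-insertOne-before i d xs i≤d

ascending-insertOne : ∀ w i xs → i ≤ length xs → ascending (suc w ∷ insertOne i (map suc xs)) ≡ false
ascending-insertOne w zero xs _ = refl
ascending-insertOne w (suc i) (x ∷ xs) (s≤s i≤) =
  trans (cong ((w <ᵇ x) ∧_) (ascending-insertOne x i xs i≤)) (∧-zeroʳ (w <ᵇ x))

ascending-1∷ : ∀ xs → Positive xs → ascending (1 ∷ map suc xs) ≡ ascending xs
ascending-1∷ [] _ = refl
ascending-1∷ (zero ∷ xs) (() ∷ _)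
ascending-1∷ (suc x ∷ xs) _ = ascending-map-suc (suc x ∷ xs)

lastDescentAt′-insertOne-before : ∀ i d τ → i ≤ d →
  lastDescentAt′ (insertOne i (map suc τ)) (suc (suc d)) ≡ lastDescentAt′ τ (suc d)
lastDescentAt′-insertOne-before i d τ i≤d =
  trans (cong lastDescentAtHead (trans (drop-insertOne-before i d (map suc τ) i≤d) (drop-map d τ)))
        (lastDescentAtHead-map-suc (drop d τ))

lastDescentAt′-insertOne-at : ∀ k τ → lastDescentAt′ (insertOne k (map suc τ)) (suc k) ≡ false
lastDescentAt′-insertOne-at zero [] = refl
lastDescentAt′-insertOne-at zero (x ∷ τ) = refl
lastDescentAt′-insertOne-at (suc zero) [] = refl
lastDescentAt′-insertOne-at (suc (suc k)) [] = refl
lastDescentAt′-insertOne-at (suc k) (x ∷ τ) = lastDescentAt′-insertOne-at k τ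

lastDescentAt′-insertOne-after : ∀ k τ → Positive τ → suc k ≤ length τ →
  lastDescentAt′ (insertOne (suc k) (map suc τ)) (suc k) ≡ ascending (drop (suc k) τ)
lastDescentAt′-insertOne-after zero (suc x ∷ τ) (_ ∷ pos) _ = ascending-1∷ τ pos
lastDescentAt′-insertOne-after (suc k) (x ∷ τ) (_ ∷ pos) (s≤s k<) =
  lastDescentAt′-insertOne-after k τ pos k<

lastDescentAt′-insertOne-beyond : ∀ k i τ → suc (suc k) ≤ i → i ≤ length τ →
  lastDescentAt′ (insertOne i (map suc τ)) (suc k) ≡ false
lastDescentAt′-insertOne-beyond zero (suc zero) τ (s≤s ()) _
lastDescentAt′-insertOne-beyond zero (suc (suc i)) (a ∷ b ∷ r) _ (s≤s (s≤s i≤)) =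
  trans (cong ((b <ᵇ a) ∧_) (ascending-insertOne b i r i≤)) (∧-zeroʳ (b <ᵇ a))
lastDescentAt′-insertOne-beyond (suc k) (suc i) (a ∷ τ) (s≤s k<i) (s≤s i≤) =
  lastDescentAt′-insertOne-beyond k i τ k<i i≤

module _ (j : ℕ) (τ : List ℕ) (pos : Positive τ) where

  private
    σ : ℕ → List ℕ
    σ i = insertOne i (map suc τ)

    counted : ℕ → ℕ → Bool
    counted k i = lastDescentAt′ (σ i) (suc k) ∧ (pmp132′ (σ i) ≡ᵇ j)

  counted-before : ∀ k i → i < k → counted k i ≡ lastDescentAt′ τ k ∧ (suc (pmp132′ τ) ≡ᵇ j)
  counted-before (suc d) i (s≤s i≤d) = begin
    counted (suc d) i
      ≡⟨ cong (_∧ (pmp132′ (σ i) ≡ᵇ j)) (lastDescentAt′-insertOne-before i d τ i≤d) ⟩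
    lastDescentAt′ τ (suc d) ∧ (pmp132′ (σ i) ≡ᵇ j)
      ≡⟨ cong (λ p → lastDescentAt′ τ (suc d) ∧ (p ≡ᵇ j)) (pmp132′-insertOne i τ) ⟩
    lastDescentAt′ τ (suc d) ∧ (pmp132′ τ + 𝟙 (starts132 0 (drop i τ)) ≡ᵇ j)
      ≡⟨ ∧-congʳ-if (lastDescentAt′ τ (suc d)) (_≡ᵇ j) (λ ld →
           trans (cong (λ b → pmp132′ τ + 𝟙 b)
                       (Equivalence.to T-≡ (lastDescentAtHead⇒starts132 i d τ pos i≤d ld)))
                 (+-comm (pmp132′ τ) 1)) ⟩
    lastDescentAt′ τ (suc d) ∧ (suc (pmp132′ τ) ≡ᵇ j) ∎
    where open ≡-Reasoning

  counted-after : ∀ k → suc k ≤ length τ →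
    counted k (suc k) ≡ ascending (drop (suc k) τ) ∧ (pmp132′ τ ≡ᵇ j)
  counted-after k k<|τ| = begin
    counted k (suc k)
      ≡⟨ cong₂ (λ b p → b ∧ (p ≡ᵇ j)) (lastDescentAt′-insertOne-after k τ pos k<|τ|)
                                       (pmp132′-insertOne (suc k) τ) ⟩
    ascending (drop (suc k) τ) ∧ (pmp132′ τ + 𝟙 (starts132 0 (drop (suc k) τ)) ≡ᵇ j)
      ≡⟨ ∧-congʳ-if (ascending (drop (suc k) τ)) (_≡ᵇ j) (λ asc →
           trans (cong (λ b → pmp132′ τ + 𝟙 b) (ascending⇒¬starts132 0 (drop (suc k) τ) asc))
                 (+-identityʳ (pmp132′ τ))) ⟩
    ascending (drop (suc k) τ) ∧ (pmp132′ τ ≡ᵇ j) ∎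
    where open ≡-Reasoning

  ∑-insertOne : ∀ k → suc k ≤ length τ →
    ∑[ i ∈ range 0 (suc (length τ)) ] 𝟙 (lastDescentAt′ (σ i) (suc k) ∧ (pmp132′ (σ i) ≡ᵇ j))
    ≡ k * 𝟙 (lastDescentAt′ τ k ∧ (suc (pmp132′ τ) ≡ᵇ j))
      + 𝟙 (ascending (drop (suc k) τ) ∧ (pmp132′ τ ≡ᵇ j))
  ∑-insertOne k k<|τ| with e , k+e≡ ← m≤n⇒∃[o]m+o≡n k<|τ| = begin
    ∑ (range 0 (suc (length τ))) w
      ≡⟨ cong (λ L → ∑ (range 0 L) w) |τ|+1≡ ⟩
    ∑ (range 0 (k + suc (suc e))) w
      ≡⟨ trans (cong (λ is → ∑ is w) (range-++ 0 k (suc (suc e)))) (∑-++ (range 0 k) _ w) ⟩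
    ∑ (range 0 k) w + (w k + (w (suc k) + ∑ (range (suc (suc k)) e) w))
      ≡⟨ cong₂ _+_ before
               (cong₂ _+_ (cong 𝟙 at-k) (cong₂ _+_ (cong 𝟙 (counted-after k k<|τ|)) beyond)) ⟩
    k * c₁ + (𝟙 (ascending (drop (suc k) τ) ∧ (pmp132′ τ ≡ᵇ j)) + 0)
      ≡⟨ cong (k * c₁ +_) (+-identityʳ _) ⟩
    k * c₁ + 𝟙 (ascending (drop (suc k) τ) ∧ (pmp132′ τ ≡ᵇ j)) ∎
    where
    open ≡-Reasoning
    w : ℕ → ℕ
    w i = 𝟙 (counted k i)
    c₁ : ℕ
    c₁ = 𝟙 (lastDescentAt′ τ k ∧ (suc (pmp132′ τ) ≡ᵇ j))
    |τ|+1≡ : suc (length τ) ≡ k + suc (suc e)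
    |τ|+1≡ = sym (trans (+-suc k (suc e)) (cong suc (trans (+-suc k e) k+e≡)))
    before : ∑ (range 0 k) w ≡ k * c₁
    before = trans (∑-const-∈ (range 0 k) c₁ λ i∈ →
                      cong 𝟙 (counted-before k _ (proj₂ (∈-range⁻ 0 k i∈))))
                   (cong (_* c₁) (length-range 0 k))
    at-k : counted k k ≡ false
    at-k = cong (_∧ (pmp132′ (σ k) ≡ᵇ j)) (lastDescentAt′-insertOne-at k τ)
    beyond : ∑ (range (suc (suc k)) e) w ≡ 0
    beyond = trans (∑-const-∈ (range (suc (suc k)) e) 0 λ {i} i∈ →
                     let 2+k≤i , i<2+k+e = ∈-range⁻ (suc (suc k)) e i∈ in
                     cong (λ b → 𝟙 (b ∧ _)) (lastDescentAt′-insertOne-beyond k i τ 2+k≤i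
                       (≤-pred (subst (i <_) (cong suc k+e≡) i<2+k+e))))
                   (*-zeroʳ (length (range (suc (suc k)) e)))


-- Permutations as insertions

Letters : ℕ → List ℕ → Set
Letters n = All (_∈ 1 ⋯ n)

Letters⇒Positive : ∀ n {σ} → Letters n σ → Positive σ
Letters⇒Positive n = All.map (λ x∈ → proj₁ (∈-range⁻ 1 n x∈))

words-suc : ∀ n m → words n (suc m) ≡ cartesianProductWith _∷_ (1 ⋯ n) (words n m)
words-suc n m = go (1 ⋯ n)
  where
  go : ∀ vs → concatMap (λ v → map (v ∷_) (words n m)) vs ≡ cartesianProductWith _∷_ vs (words n m)
  go [] = refl
  go (v ∷ vs) = cong (map (v ∷_) (words n m) ++_) (go vs)

∈-words⁻ : ∀ n m {w} → w ∈ words n m → length w ≡ m × Letters n w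
∈-words⁻ n zero (here refl) = refl , []
∈-words⁻ n (suc m) w∈
  with ∈-cartesianProductWith⁻ _∷_ (1 ⋯ n) (words n m) (subst (_ ∈_) (words-suc n m) w∈)
... | v , w , v∈ , w∈′ , refl with ∈-words⁻ n m w∈′
...   | |w|≡m , letters = cong suc |w|≡m , v∈ ∷ letters

∈-words⁺ : ∀ n m {w} → length w ≡ m → Letters n w → w ∈ words n m
∈-words⁺ n zero {[]} _ _ = here refl
∈-words⁺ n (suc m) {v ∷ w} |w|≡ (v∈ ∷ letters) =
  subst (_ ∈_) (sym (words-suc n m))
        (∈-cartesianProductWith⁺ _∷_ v∈ (∈-words⁺ n m (suc-injective |w|≡) letters))

words-unique : ∀ n m → Unique (words n m)
words-unique n zero = [] ∷ []
words-unique n (suc m) = subst Unique (sym (words-suc n m))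
  (Unique.cartesianProductWith⁺ _∷_ ∷-injective (range-unique 1 n) (words-unique n m))

IsPermutation : ℕ → List ℕ → Set
IsPermutation n σ = length σ ≡ n × Letters n σ × Unique σ

∈-S⁻ : ∀ n {σ} → σ ∈ S n → IsPermutation n σ
∈-S⁻ n σ∈ with ∈-filter⁻ (unique? _≟_) {xs = words n n} σ∈
... | σ∈words , unique with ∈-words⁻ n n σ∈words
...   | |σ|≡n , letters = |σ|≡n , letters , unique

∈-S⁺ : ∀ n {σ} → IsPermutation n σ → σ ∈ S n
∈-S⁺ n (|σ|≡n , letters , unique) = ∈-filter⁺ (unique? _≟_) (∈-words⁺ n n |σ|≡n letters) unique

S-unique : ∀ n → Unique (S n)
S-unique n = Unique.filter⁺ (unique? _≟_) (words-unique n n)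

length-insertOne : ∀ i xs → length (insertOne i xs) ≡ suc (length xs)
length-insertOne zero xs = refl
length-insertOne (suc i) [] = refl
length-insertOne (suc i) (x ∷ xs) = cong suc (length-insertOne i xs)

All-insertOne : ∀ {P : ℕ → Set} i {xs} → P 1 → All P xs → All P (insertOne i xs)
All-insertOne zero p1 ps = p1 ∷ ps
All-insertOne (suc i) p1 [] = p1 ∷ []
All-insertOne (suc i) p1 (px ∷ ps) = px ∷ All-insertOne i p1 ps

Unique-insertOne : ∀ i {xs} → All (1 ≢_) xs → Unique xs → Unique (insertOne i xs)
Unique-insertOne zero 1∉xs unique = 1∉xs ∷ unique
Unique-insertOne (suc i) [] [] = [] ∷ []
Unique-insertOne (suc i) (1≢x ∷ 1∉xs) (x∉xs ∷ unique) =
  All-insertOne i (λ x≡1 → 1≢x (sym x≡1)) x∉xs ∷ Unique-insertOne i 1∉xs unique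

insertOne-injective : ∀ i i′ τ τ′ → Positive τ → Positive τ′ → i ≤ length τ → i′ ≤ length τ′ →
  insertOne i (map suc τ) ≡ insertOne i′ (map suc τ′) → i ≡ i′ × τ ≡ τ′
insertOne-injective zero zero τ τ′ _ _ _ _ eq = refl , map-injective suc-injective (∷-injectiveʳ eq)
insertOne-injective zero (suc i′) τ (zero ∷ τ′) _ (() ∷ _) _ _ _
insertOne-injective zero (suc i′) τ (suc t′ ∷ τ′) _ _ _ _ ()
insertOne-injective (suc i) zero (zero ∷ τ) τ′ (() ∷ _) _ _ _ _
insertOne-injective (suc i) zero (suc t ∷ τ) τ′ _ _ _ _ ()
insertOne-injective (suc i) (suc i′) (t ∷ τ) (t′ ∷ τ′) (_ ∷ pos) (_ ∷ pos′) (s≤s i≤) (s≤s i′≤) eq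
  with t+1≡ , rest ← ∷-injective eq
  with refl , refl ← insertOne-injective i i′ τ τ′ pos pos′ i≤ i′≤ rest
  = refl , cong (_∷ τ) (suc-injective t+1≡)

Unique-map⁺-injectiveOn : ∀ {f : A → B} {xs} → Unique xs →
  (∀ {x y} → x ∈ xs → y ∈ xs → f x ≡ f y → x ≡ y) → Unique (map f xs)
Unique-map⁺-injectiveOn [] _ = []
Unique-map⁺-injectiveOn (x∉xs ∷ unique) inj =
  All.map⁺ (All.tabulate (λ y∈ fx≡fy → All.lookup x∉xs y∈ (inj (here refl) (there y∈) fx≡fy)))
  ∷ Unique-map⁺-injectiveOn unique (λ x∈ y∈ → inj (there x∈) (there y∈))

extend : List ℕ × ℕ → List ℕ
extend (τ , i) = insertOne i (map suc τ)

insertions : ℕ → List (List ℕ)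
insertions m = map extend (cartesianProduct (S m) (range 0 (suc m)))

IsPermutation-extend : ∀ m {τ} i → IsPermutation m τ → IsPermutation (suc m) (extend (τ , i))
IsPermutation-extend m {τ} i (|τ|≡m , letters , unique) =
  trans (length-insertOne i (map suc τ)) (cong suc (trans (length-map suc τ) |τ|≡m)) ,
  All-insertOne i (here refl) (All.map⁺ (All.map shift letters)) ,
  Unique-insertOne i (All.map⁺ (All.map 1≢suc (Letters⇒Positive m letters)))
                     (Unique.map⁺ suc-injective unique)
  where
  shift : ∀ {t} → t ∈ 1 ⋯ m → suc t ∈ 1 ⋯ suc m
  shift t∈ = there (subst (_ ∈_) (sym (range-suc 1 m)) (∈-map⁺ suc t∈))
  1≢suc : ∀ {t} → 0 < t → 1 ≢ suc t
  1≢suc 0<t 1≡1+t = <-irrefl (suc-injective 1≡1+t) 0<t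

insertions-unique : ∀ m → Unique (insertions m)
insertions-unique m =
  Unique-map⁺-injectiveOn (Unique.cartesianProduct⁺ (S-unique m) (range-unique 0 (suc m))) injective
  where
  bounds : ∀ {τ i} → (τ , i) ∈ cartesianProduct (S m) (range 0 (suc m)) → Positive τ × i ≤ length τ
  bounds {τ} p∈ with τ∈ , i∈ ← ∈-cartesianProduct⁻ (S m) (range 0 (suc m)) p∈
                 with |τ|≡m , letters , _ ← ∈-S⁻ m τ∈
    = Letters⇒Positive m letters , subst (_ ≤_) (sym |τ|≡m) (≤-pred (proj₂ (∈-range⁻ 0 (suc m) i∈)))
  injective : ∀ {p q} → p ∈ cartesianProduct (S m) (range 0 (suc m)) →
    q ∈ cartesianProduct (S m) (range 0 (suc m)) → extend p ≡ extend q → p ≡ q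
  injective {τ , i} {τ′ , i′} p∈ q∈ eq with pos , i≤ ← bounds p∈ | pos′ , i′≤ ← bounds q∈
    with refl , refl ← insertOne-injective i i′ τ τ′ pos pos′ i≤ i′≤ eq = refl

Unique⊆⇒length≤ : ∀ {xs ys : List A} → Unique xs → (∀ {x} → x ∈ xs → x ∈ ys) → length xs ≤ length ys
Unique⊆⇒length≤ {xs = []} _ _ = z≤n
Unique⊆⇒length≤ {xs = x ∷ xs} (x∉xs ∷ unique) xs⊆ys
  with as , bs , refl ← ∈-∃++ (xs⊆ys (here refl)) =
  subst (suc (length xs) ≤_) (sym (length-middle as)) (s≤s (Unique⊆⇒length≤ unique xs⊆as++bs))
  where
  length-middle : ∀ as → length (as ++ x ∷ bs) ≡ suc (length (as ++ bs))
  length-middle [] = refl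
  length-middle (a ∷ as) = cong suc (length-middle as)
  xs⊆as++bs : ∀ {y} → y ∈ xs → y ∈ as ++ bs
  xs⊆as++bs {y} y∈ with ∈-++⁻ as (xs⊆ys (there y∈))
  ... | inj₁ y∈as = ∈-++⁺ˡ y∈as
  ... | inj₂ (here y≡x) = contradiction (sym y≡x) (All.lookup x∉xs y∈)
  ... | inj₂ (there y∈bs) = ∈-++⁺ʳ as y∈bs

1∈permutation : ∀ m {σ} → IsPermutation (suc m) σ → 1 ∈ σ
1∈permutation m {σ} (|σ|≡ , letters , unique) with 1 ∈? σ
... | yes 1∈σ = 1∈σ
... | no 1∉σ = contradiction (Unique⊆⇒length≤ unique σ⊆) λ |σ|≤ →
        <-irrefl refl (subst (_≤ m) |σ|≡ (subst (length σ ≤_) (length-range 2 m) |σ|≤))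
  where
  σ⊆ : ∀ {x} → x ∈ σ → x ∈ range 2 m
  σ⊆ x∈ with All.lookup letters x∈
  ... | here refl = contradiction x∈ 1∉σ
  ... | there x∈range = x∈range

Unique-middle : ∀ (xs : List A) y ys → Unique (xs ++ y ∷ ys) → All (y ≢_) (xs ++ ys) × Unique (xs ++ ys)
Unique-middle [] y ys (y∉ys ∷ unique) = y∉ys , unique
Unique-middle (x ∷ xs) y ys (x∉ ∷ unique) with y∉ , unique′ ← Unique-middle xs y ys unique
  with x∉xs , x≢y ∷ x∉ys ← All.++⁻ xs x∉
  = (λ y≡x → x≢y (sym y≡x)) ∷ y∉ , All.++⁺ x∉xs x∉ys ∷ unique′

All-∈-map⁻ : ∀ (f : A → B) {R} ρ → All (_∈ map f R) ρ → ∃ λ τ → ρ ≡ map f τ × All (_∈ R) τ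
All-∈-map⁻ f [] [] = [] , refl , []
All-∈-map⁻ f (x ∷ ρ) (x∈ ∷ ρ∈)
  with t , t∈ , refl ← ∈-map⁻ f x∈ | τ , refl , τ∈ ← All-∈-map⁻ f ρ ρ∈
  = t ∷ τ , refl , t∈ ∷ τ∈

insertOne-++ : ∀ (pre post : List ℕ) → insertOne (length pre) (pre ++ post) ≡ pre ++ 1 ∷ post
insertOne-++ [] post = refl
insertOne-++ (x ∷ pre) post = cong (x ∷_) (insertOne-++ pre post)

∈-range-without-1 : ∀ m {x} → x ∈ 1 ⋯ suc m → 1 ≢ x → x ∈ map suc (1 ⋯ m)
∈-range-without-1 m (here refl) 1≢1 = contradiction refl 1≢1
∈-range-without-1 m (there x∈) _ = subst (_ ∈_) (range-suc 1 m) x∈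

S-suc⊆insertions : ∀ m {σ} → σ ∈ S (suc m) → σ ∈ insertions m
S-suc⊆insertions m σ∈ with perm@(|σ|≡ , letters , unique) ← ∈-S⁻ (suc m) σ∈
  with pre , post , refl ← ∈-∃++ (1∈permutation m perm)
  with 1∉ρ , uniqueρ ← Unique-middle pre 1 post unique
  with pre-letters , _ ∷ post-letters ← All.++⁻ pre letters
  with τ , ρ≡ , τ-letters ← All-∈-map⁻ suc (pre ++ post)
         (All.zipWith (λ (x∈ , 1≢x) → ∈-range-without-1 m x∈ 1≢x) (All.++⁺ pre-letters post-letters , 1∉ρ))
  = subst (_∈ insertions m) (trans (cong (insertOne (length pre)) (sym ρ≡)) (insertOne-++ pre post))
      (∈-map⁺ extend (∈-cartesianProduct⁺ (∈-S⁺ m τ-perm) (∈-range⁺ 0 (suc m) z≤n (s≤s |pre|≤m))))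
  where
  |ρ|≡m : length (pre ++ post) ≡ m
  |ρ|≡m = suc-injective (trans (sym (trans (length-++ pre) (trans (+-suc (length pre) (length post))
                                          (cong suc (sym (length-++ pre)))))) |σ|≡)
  |pre|≤m : length pre ≤ m
  |pre|≤m = subst (length pre ≤_) |ρ|≡m (length-++-≤ˡ pre)
  τ-perm : IsPermutation m τ
  τ-perm = trans (sym (length-map suc τ)) (trans (cong length (sym ρ≡)) |ρ|≡m) ,
           τ-letters , Unique.map⁻ (subst Unique ρ≡ uniqueρ)

insertions⊆S-suc : ∀ m {σ} → σ ∈ insertions m → σ ∈ S (suc m)
insertions⊆S-suc m σ∈ with (τ , i) , p∈ , refl ← ∈-map⁻ extend σ∈
  with τ∈ , _ ← ∈-cartesianProduct⁻ (S m) (range 0 (suc m)) p∈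
  = ∈-S⁺ (suc m) (IsPermutation-extend m i (∈-S⁻ m τ∈))

S-suc↭insertions : ∀ m → S (suc m) ↭ insertions m
S-suc↭insertions m = ∼bag⇒↭ (unique∧set⇒bag (S-unique (suc m)) (insertions-unique m)
  (mk⇔ (S-suc⊆insertions m) (insertions⊆S-suc m)))

∑-S-suc : ∀ m (f : List ℕ → ℕ) →
  ∑ (S (suc m)) f ≡ ∑[ τ ∈ S m ] ∑[ i ∈ range 0 (suc m) ] f (insertOne i (map suc τ))
∑-S-suc m f = trans (∑-↭ f (S-suc↭insertions m))
  (trans (∑-map f extend (cartesianProduct (S m) (range 0 (suc m))))
         (∑-cartesianProduct (S m) (range 0 (suc m)) (f ∘ extend)))


𝟙<ᵇ+𝟙>ᵇ : ∀ a c → a ≢ c → 𝟙 (a <ᵇ c) + 𝟙 (c <ᵇ a) ≡ 1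
𝟙<ᵇ+𝟙>ᵇ zero zero a≢c = contradiction refl a≢c
𝟙<ᵇ+𝟙>ᵇ zero (suc c) _ = refl
𝟙<ᵇ+𝟙>ᵇ (suc a) zero _ = refl
𝟙<ᵇ+𝟙>ᵇ (suc a) (suc c) a≢c = 𝟙<ᵇ+𝟙>ᵇ a c (a≢c ∘ cong suc)

ascending-drop-1 : ∀ ys → Unique ys →
  𝟙 (ascending (drop 1 ys)) ≡ 𝟙 (ascending ys) + 𝟙 (lastDescentAtHead ys)
ascending-drop-1 [] _ = refl
ascending-drop-1 (a ∷ []) _ = refl
ascending-drop-1 (a ∷ c ∷ r) ((a≢c ∷ _) ∷ _) = begin
  𝟙 asc                                    ≡⟨ *-identityˡ (𝟙 asc) ⟨
  1 * 𝟙 asc                                ≡⟨ cong (_* 𝟙 asc) (𝟙<ᵇ+𝟙>ᵇ a c a≢c) ⟨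
  (𝟙 (a <ᵇ c) + 𝟙 (c <ᵇ a)) * 𝟙 asc        ≡⟨ *-distribʳ-+ (𝟙 asc) (𝟙 (a <ᵇ c)) (𝟙 (c <ᵇ a)) ⟩
  𝟙 (a <ᵇ c) * 𝟙 asc + 𝟙 (c <ᵇ a) * 𝟙 asc  ≡⟨ cong₂ _+_ (𝟙-∧ (a <ᵇ c) asc) (𝟙-∧ (c <ᵇ a) asc) ⟨
  𝟙 ((a <ᵇ c) ∧ asc) + 𝟙 ((c <ᵇ a) ∧ asc)  ∎
  where
  open ≡-Reasoning
  asc : Bool
  asc = ascending (c ∷ r)

ascending-drop : ∀ k τ → Unique τ →
  𝟙 (ascending (drop k τ)) ≡ 𝟙 (ascending τ) + ∑[ ℓ ∈ 1 ⋯ k ] 𝟙 (lastDescentAt′ τ ℓ)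
ascending-drop zero τ _ = sym (+-identityʳ _)
ascending-drop (suc k) τ unique = begin
  𝟙 (ascending (drop (suc k) τ))
    ≡⟨ cong (𝟙 ∘ ascending) (trans (cong (λ n → drop n τ) (+-comm 1 k)) (sym (drop-drop k 1 τ))) ⟩
  𝟙 (ascending (drop 1 (drop k τ)))
    ≡⟨ ascending-drop-1 (drop k τ) (Unique.drop⁺ k unique) ⟩
  𝟙 (ascending (drop k τ)) + 𝟙 (lastDescentAt′ τ (suc k))
    ≡⟨ cong (_+ 𝟙 (lastDescentAt′ τ (suc k))) (ascending-drop k τ unique) ⟩
  𝟙 (ascending τ) + ∑ (range 1 k) d + d (suc k)
    ≡⟨ +-assoc (𝟙 (ascending τ)) _ _ ⟩
  𝟙 (ascending τ) + (∑ (range 1 k) d + d (suc k))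
    ≡⟨ cong (𝟙 (ascending τ) +_) (∑-range-suc 1 k d) ⟨
  𝟙 (ascending τ) + ∑ (range 1 (suc k)) d ∎
  where
  open ≡-Reasoning
  d : ℕ → ℕ
  d ℓ = 𝟙 (lastDescentAt′ τ ℓ)

ascending-drop-∧ : ∀ k τ b → Unique τ →
  𝟙 (ascending (drop k τ) ∧ b) ≡ 𝟙 (ascending τ ∧ b) + ∑[ ℓ ∈ 1 ⋯ k ] 𝟙 (lastDescentAt′ τ ℓ ∧ b)
ascending-drop-∧ k τ b unique = begin
  𝟙 (ascending (drop k τ) ∧ b)
    ≡⟨ 𝟙-∧ (ascending (drop k τ)) b ⟩
  𝟙 (ascending (drop k τ)) * 𝟙 b
    ≡⟨ cong (_* 𝟙 b) (ascending-drop k τ unique) ⟩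
  (𝟙 (ascending τ) + ∑ (1 ⋯ k) d) * 𝟙 b
    ≡⟨ *-distribʳ-+ (𝟙 b) (𝟙 (ascending τ)) (∑ (1 ⋯ k) d) ⟩
  𝟙 (ascending τ) * 𝟙 b + ∑ (1 ⋯ k) d * 𝟙 b
    ≡⟨ cong₂ _+_ (sym (𝟙-∧ (ascending τ) b)) (trans (sym (∑-*ʳ (1 ⋯ k) (𝟙 b) d))
                                               (∑-cong (λ ℓ → sym (𝟙-∧ (lastDescentAt′ τ ℓ) b)) (1 ⋯ k))) ⟩
  𝟙 (ascending τ ∧ b) + ∑[ ℓ ∈ 1 ⋯ k ] 𝟙 (lastDescentAt′ τ ℓ ∧ b) ∎
  where
  open ≡-Reasoning
  d : ℕ → ℕ
  d ℓ = 𝟙 (lastDescentAt′ τ ℓ)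

∑-ascending-insertOne : ∀ τ → Positive τ →
  ∑[ i ∈ range 0 (suc (length τ)) ] 𝟙 (ascending (insertOne i (map suc τ))) ≡ 𝟙 (ascending τ)
∑-ascending-insertOne τ pos = begin
  𝟙 (ascending (1 ∷ map suc τ)) + ∑ (range 1 (length τ)) a
    ≡⟨ cong₂ _+_ (cong 𝟙 (ascending-1∷ τ pos)) (∑-const-∈ (range 1 (length τ)) 0 later) ⟩
  𝟙 (ascending τ) + length (range 1 (length τ)) * 0
    ≡⟨ cong (𝟙 (ascending τ) +_) (*-zeroʳ (length (range 1 (length τ)))) ⟩
  𝟙 (ascending τ) + 0
    ≡⟨ +-identityʳ (𝟙 (ascending τ)) ⟩
  𝟙 (ascending τ) ∎
  where
  open ≡-Reasoning
  a : ℕ → ℕ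
  a i = 𝟙 (ascending (insertOne i (map suc τ)))
  unsorted : ∀ i υ → i < length υ → ascending (insertOne (suc i) (map suc υ)) ≡ false
  unsorted i (t ∷ υ) (s≤s i≤) = ascending-insertOne t i υ i≤
  later : ∀ {i} → i ∈ range 1 (length τ) → a i ≡ 0
  later {zero} i∈ with () ← proj₁ (∈-range⁻ 1 (length τ) i∈)
  later {suc i} i∈ = cong 𝟙 (unsorted i τ (≤-pred (proj₂ (∈-range⁻ 1 (length τ) i∈))))

count-ascending : ∀ m → ∑[ τ ∈ S m ] 𝟙 (ascending τ) ≡ 1
count-ascending zero = refl
count-ascending (suc m) = begin
  ∑ (S (suc m)) (𝟙 ∘ ascending)
    ≡⟨ ∑-S-suc m (𝟙 ∘ ascending) ⟩
  ∑[ τ ∈ S m ] ∑[ i ∈ range 0 (suc m) ] 𝟙 (ascending (insertOne i (map suc τ)))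
    ≡⟨ ∑-cong-∈ (S m) inner ⟩
  ∑ (S m) (𝟙 ∘ ascending)
    ≡⟨ count-ascending m ⟩
  1 ∎
  where
  open ≡-Reasoning
  inner : ∀ {τ} → τ ∈ S m →
    ∑[ i ∈ range 0 (suc m) ] 𝟙 (ascending (insertOne i (map suc τ))) ≡ 𝟙 (ascending τ)
  inner τ∈ with refl , letters , _ ← ∈-S⁻ m τ∈ = ∑-ascending-insertOne _ (Letters⇒Positive m letters)

ascending⇒pmp132′≡0 : ∀ τ → T (ascending τ) → pmp132′ τ ≡ 0
ascending⇒pmp132′≡0 [] _ = refl
ascending⇒pmp132′≡0 (x ∷ τ) asc =
  cong₂ (λ b p → 𝟙 b + p) (ascending⇒¬starts132 x τ (ascending-tail x τ asc))
                          (ascending⇒pmp132′≡0 τ (ascending-tail x τ asc))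

∑-ascending : ∀ m j → ∑[ τ ∈ S m ] 𝟙 (ascending τ ∧ (pmp132′ τ ≡ᵇ j)) ≡ one j
∑-ascending m j = begin
  ∑[ τ ∈ S m ] 𝟙 (ascending τ ∧ (pmp132′ τ ≡ᵇ j))
    ≡⟨ ∑-cong (λ τ → cong 𝟙 (∧-congʳ-if (ascending τ) (_≡ᵇ j) (ascending⇒pmp132′≡0 τ))) (S m) ⟩
  ∑[ τ ∈ S m ] 𝟙 (ascending τ ∧ (0 ≡ᵇ j))
    ≡⟨ ∑-cong (λ τ → 𝟙-∧ (ascending τ) (0 ≡ᵇ j)) (S m) ⟩
  ∑[ τ ∈ S m ] (𝟙 (ascending τ) * 𝟙 (0 ≡ᵇ j))
    ≡⟨ ∑-*ʳ (S m) (𝟙 (0 ≡ᵇ j)) (𝟙 ∘ ascending) ⟩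
  ∑ (S m) (𝟙 ∘ ascending) * 𝟙 (0 ≡ᵇ j)
    ≡⟨ cong (_* 𝟙 (0 ≡ᵇ j)) (count-ascending m) ⟩
  1 * 𝟙 (0 ≡ᵇ j)
    ≡⟨ trans (*-identityˡ (𝟙 (0 ≡ᵇ j))) (𝟙[0≡ᵇ]≡one j) ⟩
  one j ∎
  where
  open ≡-Reasoning
  𝟙[0≡ᵇ]≡one : ∀ j → 𝟙 (0 ≡ᵇ j) ≡ one j
  𝟙[0≡ᵇ]≡one zero = refl
  𝟙[0≡ᵇ]≡one (suc j) = refl

∑-shifted : ∀ m k j → ∑[ τ ∈ S m ] 𝟙 (lastDescentAt′ τ k ∧ (suc (pmp132′ τ) ≡ᵇ j)) ≡ X* (P m k) j
∑-shifted m k zero =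
  trans (∑-const-∈ (S m) 0 λ {τ} _ → cong 𝟙 (∧-zeroʳ (lastDescentAt′ τ k))) (*-zeroʳ (length (S m)))
∑-shifted m k (suc j) = sym (P≡∑ m k j)

∑-ascending-suffix : ∀ m k j →
  ∑[ τ ∈ S m ] 𝟙 (ascending (drop k τ) ∧ (pmp132′ τ ≡ᵇ j)) ≡ one j + ΣP 1 k (P m) j
∑-ascending-suffix m k j = begin
  ∑[ τ ∈ S m ] 𝟙 (ascending (drop k τ) ∧ (pmp132′ τ ≡ᵇ j))
    ≡⟨ ∑-cong-∈ (S m) (λ τ∈ → ascending-drop-∧ k _ _ (proj₂ (proj₂ (∈-S⁻ m τ∈)))) ⟩
  ∑[ τ ∈ S m ] (𝟙 (ascending τ ∧ (pmp132′ τ ≡ᵇ j))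
                + ∑[ ℓ ∈ 1 ⋯ k ] 𝟙 (lastDescentAt′ τ ℓ ∧ (pmp132′ τ ≡ᵇ j)))
    ≡⟨ ∑-+ (S m) _ _ ⟩
  ∑[ τ ∈ S m ] 𝟙 (ascending τ ∧ (pmp132′ τ ≡ᵇ j))
    + ∑[ τ ∈ S m ] ∑[ ℓ ∈ 1 ⋯ k ] 𝟙 (lastDescentAt′ τ ℓ ∧ (pmp132′ τ ≡ᵇ j))
    ≡⟨ cong₂ _+_ (∑-ascending m j) (∑-swap (S m) (1 ⋯ k) _) ⟩
  one j + ∑[ ℓ ∈ 1 ⋯ k ] ∑[ τ ∈ S m ] 𝟙 (lastDescentAt′ τ ℓ ∧ (pmp132′ τ ≡ᵇ j))
    ≡⟨ cong (one j +_) (trans (∑-cong (λ ℓ → sym (P≡∑ m ℓ j)) (1 ⋯ k)) (sym (ΣP-∑ 1 k (P m) j))) ⟩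
  one j + ΣP 1 k (P m) j ∎
  where open ≡-Reasoning

lemma3 : (n k : ℕ) → 2 ≤ n → 1 ≤ k → k ≤ n ∸ 1 → (j : ℕ) →
    P n k j ≡ ((k ∸ 1) ⊙ X* (P (n ∸ 1) (k ∸ 1)) ⊕ one ⊕ ΣP 1 k (P (n ∸ 1))) j
lemma3 (suc m) (suc k) _ _ k<m j = begin
  P (suc m) (suc k) j
    ≡⟨ P≡∑ (suc m) (suc k) j ⟩
  ∑ (S (suc m)) weight
    ≡⟨ ∑-S-suc m weight ⟩
  ∑[ τ ∈ S m ] ∑[ i ∈ range 0 (suc m) ] weight (insertOne i (map suc τ))
    ≡⟨ ∑-cong-∈ (S m) per-τ ⟩
  ∑[ τ ∈ S m ] (k * shifted τ + suffix τ)
    ≡⟨ trans (∑-+ (S m) (λ τ → k * shifted τ) suffix)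
             (cong (_+ ∑ (S m) suffix) (∑-*ˡ (S m) k shifted)) ⟩
  k * ∑ (S m) shifted + ∑ (S m) suffix
    ≡⟨ cong₂ (λ a b → k * a + b) (∑-shifted m k j) (∑-ascending-suffix m (suc k) j) ⟩
  k * X* (P m k) j + (one j + ΣP 1 (suc k) (P m) j)
    ≡⟨ +-assoc (k * X* (P m k) j) (one j) _ ⟨
  k * X* (P m k) j + one j + ΣP 1 (suc k) (P m) j ∎
  where
  open ≡-Reasoning
  weight shifted suffix : List ℕ → ℕ
  weight σ = 𝟙 (lastDescentAt′ σ (suc k) ∧ (pmp132′ σ ≡ᵇ j))
  shifted τ = 𝟙 (lastDescentAt′ τ k ∧ (suc (pmp132′ τ) ≡ᵇ j))
  suffix τ = 𝟙 (ascending (drop (suc k) τ) ∧ (pmp132′ τ ≡ᵇ j))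
  per-τ : ∀ {τ} → τ ∈ S m →
    ∑[ i ∈ range 0 (suc m) ] weight (insertOne i (map suc τ)) ≡ k * shifted τ + suffix τ
  per-τ τ∈ with refl , letters , _ ← ∈-S⁻ m τ∈ = ∑-insertOne j _ (Letters⇒Positive _ letters) k k<m
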